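{- After $M$ moves, a locally-greedy asynchronous collective tree exploration algorithm with targets (with $k$ robots) has explored at least $$\frac{1}{2}\left(M-\sum_{r\in[k]}\sum_{t<M}\Big(d(p_{t+1}(r),v_{t+1}(r))-d(p_{t+1}(r),v_t(r))\Big)\right)$$ edges, where $v_t(r)$ denotes the target of robot $r$ at move $t$, $p_t(r)$ its position, and $d$ the distance in the tree.
   Context: Asynchronous collective tree exploration (ACTE): $k$ robots start at the root of an unknown tree; at each step $t$ an arbitrary (adversarially chosen) robot $r_t\in\{1,\dots,k\}$ is the only one allowed to move, along one adjacent edge; at the beginning of move $t$ the centrally controlled team is only additionally told whether $r_t$ is adjacent to an unexplored edge, and if so can move along it. A locally-greedy ACTE algorithm with targets maintains at all times, for each robot $r$, an already explored node $v_t(r)$ called its target (initially the root, where all robots start), and the $t$-th move is determined by: R1. if robot $r_t$ is adjacent to an unexplored edge, it moves along that edge; R2. otherwise it moves along the adjacent edge leading towards its target $v_t(r_t)$; R3. robot $r_t$ does not stay at its location (so the target is changed beforehand if $r_t$ is at its target and not adjacent to an unexplored edge). -}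

module Defs where

open import Data.Nat using (ℕ; zero; suc; _≤_; _<_)
open import Data.Fin using (Fin; zero; suc; toℕ)
open import Data.Integer as ℤ using (ℤ; +_; _-_)
open import Data.List using (List; foldr; map; upTo; allFin)
open import Data.Product using (Σ; ∃; ∃-syntax; _×_; _,_)
open import Data.Sum using (_⊎_)
open import Relation.Nullary using (¬_)
open import Relation.Binary.PropositionalEquality using (_≡_; _≢_)

-- Node  suc i  (i : Fin n) has parent  parent i, whose index is smaller,
-- so the parent relation is acyclic and every node reaches the root.
-- Every finite tree (rooted anywhere) is isomorphic to such a tree
-- (label nodes e.g. in BFS order).  Edges are identified with their
-- child endpoint: edge  i : Fin n  joins  suc i  and  parent i.

record Tree (n : ℕ) : Set where
  field
    parent    : Fin n → Fin (suc n)
    parent<   : ∀ i → toℕ (parent i) < toℕ (suc i)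

module _ {n : ℕ} (T : Tree n) where
  open Tree T

  Node : Set
  Node = Fin (suc n)

  Edge : Set
  Edge = Fin n

  root : Node
  root = zero

  Traverses : Node → Node → Edge → Set
  Traverses a b e = (a ≡ suc e × b ≡ parent e) ⊎ (a ≡ parent e × b ≡ suc e)

  Incident : Node → Edge → Set
  Incident a e = a ≡ suc e ⊎ a ≡ parent e

  Adjacent : Node → Node → Set
  Adjacent a b = ∃[ e ] Traverses a b e

  data Walk : Node → Node → ℕ → Set where
    here : ∀ {a} → Walk a a 0
    step : ∀ {a b c m} → Adjacent a b → Walk b c m → Walk a c (suc m)

  IsDist : Node → Node → ℕ → Set
  IsDist a b m = Walk a b m × (∀ m′ → Walk a b m′ → m ≤ m′)

  IsDistance : (Node → Node → ℕ) → Set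
  IsDistance d = ∀ a b → IsDist a b (d a b)

  -- Runs of an asynchronous exploration with k robots.
  --   p t ρ : position of robot ρ at the beginning of move t
  --           (move t takes p t to p (suc t)); moves are t = 0,1,…
  --   r t   : the (adversarially chosen) robot allowed to move at move t
  --   v t ρ : target of robot ρ used at move t
  module Run {k : ℕ} (p : ℕ → Fin k → Node) (r : ℕ → Fin k)
             (v : ℕ → Fin k → Node) where

    ExploredEdge : ℕ → Edge → Set
    ExploredEdge t e = ∃[ s ] (s < t × Traverses (p s (r s)) (p (suc s) (r s)) e)

    ExploredNode : ℕ → Node → Set
    ExploredNode t a = ∃[ s ] ∃[ ρ ] (s ≤ t × p s ρ ≡ a)

    NearUnexplored : ℕ → Node → Set
    NearUnexplored t a = ∃[ e ] (Incident a e × ¬ ExploredEdge t e)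

    record LocallyGreedy (d : Node → Node → ℕ) (M : ℕ) : Set where
      field
        start   : ∀ ρ → p 0 ρ ≡ root
        others  : ∀ t ρ → t < M → ρ ≢ r t → p (suc t) ρ ≡ p t ρ
        target  : ∀ t ρ → t ≤ M → ExploredNode t (v t ρ)
        rule1   : ∀ t → t < M → NearUnexplored t (p t (r t)) →
                  ∃[ e ] (¬ ExploredEdge t e ×
                          Traverses (p t (r t)) (p (suc t) (r t)) e)
        rule2   : ∀ t → t < M → ¬ NearUnexplored t (p t (r t)) →
                  Adjacent (p t (r t)) (p (suc t) (r t)) ×
                  suc (d (p (suc t) (r t)) (v t (r t))) ≡ d (p t (r t)) (v t (r t))
        rule3   : ∀ t → t < M → ¬ NearUnexplored t (p t (r t)) →
                  p t (r t) ≢ v t (r t)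

sumℤ : List ℤ → ℤ
sumℤ = foldr ℤ._+_ (+ 0)

targetDrift : ∀ {N k : ℕ} → (Fin N → Fin N → ℕ) →
              (ℕ → Fin k → Fin N) → (ℕ → Fin k → Fin N) → ℕ → ℤ
targetDrift {k = k} d p v M =
  sumℤ (map (λ ρ → sumℤ (map (λ t →
      (+ d (p (suc t) ρ) (v (suc t) ρ)) - (+ d (p (suc t) ρ) (v t ρ)))
    (upTo M))) (allFin k))

{-# OPTIONS --safe #-}
module Submission where

-- Consider the potential Φ t = Σ_ρ d(p_t ρ, v_t ρ), which is 0 at the start and never negative.
-- A move by rule R2 decreases the mover's distance to its target by one; a move by rule R1
-- explores a new edge and increases that distance by at most one.  Hence each move adds at most
-- 2·(number of newly explored edges) − 1 to Φ, apart from the retargeting changes, whose total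
-- is exactly the drift term.  So t + Φ t − drift t ≤ 2·#explored t is invariant, and Φ M ≥ 0.

open import Defs
open import Data.Nat using (ℕ)
open import Data.Fin using (Fin)
open import Data.Integer using (ℤ; +_; _-_; _*_; _≤_)
open import Data.List using (length)
open import Data.List.Relation.Unary.All using (All)
open import Data.List.Relation.Unary.Unique.Propositional using (Unique)
open import Data.Product using (∃-syntax; _×_)

import Data.Nat as ℕ
import Data.Nat.Properties as ℕ
import Data.Fin as Fin
import Data.Fin.Properties as Fin
open import Data.Integer using (_+_; -_; +≤+)
import Data.Integer.Properties as ℤ
open import Data.Integer.Tactic.RingSolver using (solve-∀)
open import Data.List using ([]; _∷_; map; tabulate; upTo; allFin; _∷ʳ_)
import Data.List.Properties as List
import Data.List.Relation.Unary.All as All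
open import Data.List.Relation.Unary.AllPairs using ([]; _∷_)
open import Data.Product using (_,_; proj₁; proj₂)
open import Data.Sum using (inj₁; inj₂)
open import Relation.Nullary using (¬_; Dec; yes; no)
open import Relation.Nullary.Decidable using (_×-dec_; _⊎-dec_; ¬?)
open import Relation.Binary.PropositionalEquality
open import Function using (_∘_)

sumℤ-map-cong : ∀ {A : Set} {f g : A → ℤ} → (∀ x → f x ≡ g x) →
  ∀ xs → sumℤ (map f xs) ≡ sumℤ (map g xs)
sumℤ-map-cong f≡g []       = refl
sumℤ-map-cong f≡g (x ∷ xs) = cong₂ _+_ (f≡g x) (sumℤ-map-cong f≡g xs)

sumℤ-map-zero : ∀ {A : Set} {f : A → ℤ} → (∀ x → f x ≡ + 0) →
  ∀ xs → sumℤ (map f xs) ≡ + 0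
sumℤ-map-zero f≡0 []       = refl
sumℤ-map-zero f≡0 (x ∷ xs) = cong₂ _+_ (f≡0 x) (sumℤ-map-zero f≡0 xs)

sumℤ-map-nonneg : ∀ {A : Set} (f : A → ℕ) xs → + 0 ≤ sumℤ (map (λ x → + f x) xs)
sumℤ-map-nonneg f []       = ℤ.≤-refl
sumℤ-map-nonneg f (x ∷ xs) = ℤ.+-mono-≤ (+≤+ ℕ.z≤n) (sumℤ-map-nonneg f xs)

sumℤ-map-+ : ∀ {A : Set} (f g : A → ℤ) xs →
  sumℤ (map (λ x → f x + g x) xs) ≡ sumℤ (map f xs) + sumℤ (map g xs)
sumℤ-map-+ f g []       = refl
sumℤ-map-+ f g (x ∷ xs) rewrite sumℤ-map-+ f g xs =
  interchange (f x) (g x) (sumℤ (map f xs)) (sumℤ (map g xs))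
  where
  interchange : ∀ a b c e → (a + b) + (c + e) ≡ (a + c) + (b + e)
  interchange = solve-∀

sumℤ-map-- : ∀ {A : Set} (f g : A → ℤ) xs →
  sumℤ (map (λ x → f x - g x) xs) ≡ sumℤ (map f xs) - sumℤ (map g xs)
sumℤ-map-- f g []       = refl
sumℤ-map-- f g (x ∷ xs) rewrite sumℤ-map-- f g xs =
  interchange (f x) (g x) (sumℤ (map f xs)) (sumℤ (map g xs))
  where
  interchange : ∀ a b c e → (a - b) + (c - e) ≡ (a + c) - (b + e)
  interchange = solve-∀

sumℤ-map-∷ʳ : ∀ {A : Set} (f : A → ℤ) xs x →
  sumℤ (map f (xs ∷ʳ x)) ≡ sumℤ (map f xs) + f x
sumℤ-map-∷ʳ f []       x = trans (ℤ.+-identityʳ (f x)) (sym (ℤ.+-identityˡ (f x)))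
sumℤ-map-∷ʳ f (y ∷ xs) x =
  trans (cong (λ s → f y + s) (sumℤ-map-∷ʳ f xs x)) (sym (ℤ.+-assoc (f y) _ (f x)))

sumℤ-map-upTo-suc : ∀ (f : ℕ → ℤ) t →
  sumℤ (map f (upTo (ℕ.suc t))) ≡ sumℤ (map f (upTo t)) + f t
sumℤ-map-upTo-suc f t =
  trans (cong (sumℤ ∘ map f) (sym (List.upTo-∷ʳ t))) (sumℤ-map-∷ʳ f (upTo t) t)

sumℤ-tabulate-update : ∀ {k} (f g : Fin k → ℤ) ρ₀ → (∀ ρ → ρ ≢ ρ₀ → f ρ ≡ g ρ) →
  sumℤ (tabulate f) ≡ sumℤ (tabulate g) + (f ρ₀ - g ρ₀)
sumℤ-tabulate-update {ℕ.suc k} f g Fin.zero f≡g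
  rewrite List.tabulate-cong {f = f ∘ Fin.suc} {g = g ∘ Fin.suc} (λ ρ → f≡g (Fin.suc ρ) λ ())
  = shuffle (f Fin.zero) (g Fin.zero) (sumℤ (tabulate (g ∘ Fin.suc)))
  where
  shuffle : ∀ a b c → a + c ≡ (b + c) + (a - b)
  shuffle = solve-∀
sumℤ-tabulate-update {ℕ.suc k} f g (Fin.suc ρ₀) f≡g
  rewrite f≡g Fin.zero (λ ())
        | sumℤ-tabulate-update (f ∘ Fin.suc) (g ∘ Fin.suc) ρ₀
            (λ ρ ρ≢ρ₀ → f≡g (Fin.suc ρ) (ρ≢ρ₀ ∘ Fin.suc-injective))
  = sym (ℤ.+-assoc (g Fin.zero) _ _)

sumℤ-allFin-update : ∀ {k} (f g : Fin k → ℤ) ρ₀ → (∀ ρ → ρ ≢ ρ₀ → f ρ ≡ g ρ) →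
  sumℤ (map f (allFin k)) ≡ sumℤ (map g (allFin k)) + (f ρ₀ - g ρ₀)
sumℤ-allFin-update {k} f g ρ₀ f≡g
  rewrite List.map-tabulate {n = k} (λ ρ → ρ) f | List.map-tabulate {n = k} (λ ρ → ρ) g
  = sumℤ-tabulate-update f g ρ₀ f≡g

1+m-n≤2 : ∀ {m n} → m ℕ.≤ ℕ.suc n → + 1 + (+ m - + n) ≤ + 2
1+m-n≤2 {m} {n} m≤1+n = begin
  + 1 + (+ m - + n)        ≤⟨ ℤ.+-monoʳ-≤ (+ 1) (ℤ.+-monoˡ-≤ (- + n) (+≤+ m≤1+n)) ⟩
  + 1 + (+ 1 + + n - + n)  ≡⟨ cancel (+ n) ⟩
  + 2                      ∎
  where
  open ℤ.≤-Reasoning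
  cancel : ∀ i → + 1 + (+ 1 + i - i) ≡ + 2
  cancel = solve-∀

1+m-n≡0 : ∀ {m n} → ℕ.suc m ≡ n → + 1 + (+ m - + n) ≡ + 0
1+m-n≡0 {m} refl = cancel (+ m)
  where
  cancel : ∀ i → + 1 + (i - (+ 1 + i)) ≡ + 0
  cancel = solve-∀

module TargetDrift {N k : ℕ} (d : Fin N → Fin N → ℕ) (p v : ℕ → Fin k → Fin N) where

  potential : ℕ → ℤ
  potential t = sumℤ (map (λ ρ → + d (p t ρ) (v t ρ)) (allFin k))

  potentialAfterMove : ℕ → ℤ
  potentialAfterMove t = sumℤ (map (λ ρ → + d (p (ℕ.suc t) ρ) (v t ρ)) (allFin k))

  targetDrift-suc : ∀ t → targetDrift d p v (ℕ.suc t) ≡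
    targetDrift d p v t + (potential (ℕ.suc t) - potentialAfterMove t)
  targetDrift-suc t = begin
    targetDrift d p v (ℕ.suc t)
      ≡⟨ sumℤ-map-cong (λ ρ → sumℤ-map-upTo-suc (retarget ρ) t) (allFin k) ⟩
    sumℤ (map (λ ρ → sumℤ (map (retarget ρ) (upTo t)) + retarget ρ t) (allFin k))
      ≡⟨ sumℤ-map-+ (λ ρ → sumℤ (map (retarget ρ) (upTo t))) (λ ρ → retarget ρ t) (allFin k) ⟩
    targetDrift d p v t + sumℤ (map (λ ρ → retarget ρ t) (allFin k))
      ≡⟨ cong (λ s → targetDrift d p v t + s) (sumℤ-map-- _ _ (allFin k)) ⟩
    targetDrift d p v t + (potential (ℕ.suc t) - potentialAfterMove t) ∎
    where
    open ≡-Reasoning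
    retarget : Fin k → ℕ → ℤ
    retarget ρ s = + d (p (ℕ.suc s) ρ) (v (ℕ.suc s) ρ) - + d (p (ℕ.suc s) ρ) (v s ρ)

module _ {n : ℕ} (T : Tree n) where
  open Tree T

  traverses? : ∀ a b e → Dec (Traverses T a b e)
  traverses? a b e = ((a Fin.≟ Fin.suc e) ×-dec (b Fin.≟ parent e))
                ⊎-dec ((a Fin.≟ parent e) ×-dec (b Fin.≟ Fin.suc e))

  incident? : ∀ a e → Dec (Incident T a e)
  incident? a e = (a Fin.≟ Fin.suc e) ⊎-dec (a Fin.≟ parent e)

  Adjacent-sym : ∀ {a b} → Adjacent T a b → Adjacent T b a
  Adjacent-sym (e , inj₁ (a≡ , b≡)) = e , inj₂ (b≡ , a≡)
  Adjacent-sym (e , inj₂ (a≡ , b≡)) = e , inj₁ (b≡ , a≡)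

  module _ {d : Node T → Node T → ℕ} (isDistance : IsDistance T d) where

    dist-refl : ∀ a → d a a ≡ 0
    dist-refl a = ℕ.n≤0⇒n≡0 (proj₂ (isDistance a a) 0 here)

    dist-adjacent : ∀ {a b} c → Adjacent T a b → d b c ℕ.≤ ℕ.suc (d a c)
    dist-adjacent {a} {b} c a~b =
      proj₂ (isDistance b c) _ (step (Adjacent-sym a~b) (proj₁ (isDistance a c)))

  module _ {k : ℕ} (p : ℕ → Fin k → Node T) (r : ℕ → Fin k) (v : ℕ → Fin k → Node T) where
    open Run T p r v

    explored? : ∀ t e → Dec (ExploredEdge t e)
    explored? t e = ℕ.anyUpTo? (λ s → traverses? (p s (r s)) (p (ℕ.suc s) (r s)) e) t

    nearUnexplored? : ∀ t a → Dec (NearUnexplored t a)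
    nearUnexplored? t a = Fin.any? (λ e → incident? a e ×-dec ¬? (explored? t e))

    explored-suc : ∀ {t e} → ExploredEdge t e → ExploredEdge (ℕ.suc t) e
    explored-suc (s , s<t , tr) = s , ℕ.m<n⇒m<1+n s<t , tr

module Exploration {n k : ℕ} (T : Tree n) {d : Node T → Node T → ℕ} (isDistance : IsDistance T d)
                   (p : ℕ → Fin k → Node T) (r : ℕ → Fin k) (v : ℕ → Fin k → Node T)
                   {M : ℕ} (greedy : Run.LocallyGreedy T p r v d M) where
  open Run T p r v
  open LocallyGreedy greedy
  open TargetDrift d p v

  balance : ℕ → ℤ
  balance t = potential t - targetDrift d p v t

  moverDelta : ℕ → ℤ
  moverDelta t = + d (p (ℕ.suc t) (r t)) (v t (r t)) - + d (p t (r t)) (v t (r t))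

  target-zero : ∀ ρ → v 0 ρ ≡ root T
  target-zero ρ with target 0 ρ ℕ.z≤n
  ... | 0 , ρ′ , ℕ.z≤n , p0ρ′≡v0ρ = trans (sym p0ρ′≡v0ρ) (start ρ′)

  balance-zero : balance 0 ≡ + 0
  balance-zero =
    cong₂ _-_ (sumℤ-map-zero atTarget (allFin k)) (sumℤ-map-zero (λ _ → refl) (allFin k))
    where
    atTarget : ∀ ρ → + d (p 0 ρ) (v 0 ρ) ≡ + 0
    atTarget ρ rewrite start ρ | target-zero ρ = cong +_ (dist-refl T isDistance (root T))

  potentialAfterMove-mover : ∀ t → t ℕ.< M → potentialAfterMove t ≡ potential t + moverDelta t
  potentialAfterMove-mover t t<M = sumℤ-allFin-update _ _ (r t)
    (λ ρ ρ≢rt → cong (λ a → + d a (v t ρ)) (others t ρ t<M ρ≢rt))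

  balance-suc : ∀ t → t ℕ.< M → balance (ℕ.suc t) ≡ balance t + moverDelta t
  balance-suc t t<M = begin
    P′ - targetDrift d p v (ℕ.suc t)  ≡⟨ cong (λ D′ → P′ - D′) (targetDrift-suc t) ⟩
    P′ - (D + (P′ - A))               ≡⟨ cong (λ A′ → P′ - (D + (P′ - A′))) (potentialAfterMove-mover t t<M) ⟩
    P′ - (D + (P′ - (P + δ)))         ≡⟨ regroup P P′ D δ ⟩
    P - D + δ                         ∎
    where
    open ≡-Reasoning
    P P′ A D δ : ℤ
    P = potential t
    P′ = potential (ℕ.suc t)
    A = potentialAfterMove t
    D = targetDrift d p v t
    δ = moverDelta t
    regroup : ∀ P P′ D δ → P′ - (D + (P′ - (P + δ))) ≡ P - D + δ
    regroup = solve-∀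

  progress : ℕ → ℤ
  progress t = + t + balance t

  progress-suc : ∀ t → t ℕ.< M → progress (ℕ.suc t) ≡ progress t + (+ 1 + moverDelta t)
  progress-suc t t<M = trans (cong (λ b → + ℕ.suc t + b) (balance-suc t t<M))
                             (regroup (+ t) (balance t) (moverDelta t))
    where
    regroup : ∀ i b δ → + 1 + i + (b + δ) ≡ i + b + (+ 1 + δ)
    regroup = solve-∀

  Invariant : ℕ → Set
  Invariant t = ∃[ es ] (Unique es × All (ExploredEdge t) es × progress t ≤ + 2 * + length es)

  invariant-explore : ∀ t → t ℕ.< M → NearUnexplored t (p t (r t)) → Invariant t → Invariant (ℕ.suc t)
  invariant-explore t t<M near (es , unique , explored , bound) with rule1 t t<M near
  ... | e , unexplored , traversed =
    e ∷ es , All.map (λ ex → λ { refl → unexplored ex }) explored ∷ unique ,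
    (t , ℕ.n<1+n t , traversed) All.∷ All.map (explored-suc T p r v) explored ,
    (begin
      progress (ℕ.suc t)              ≡⟨ progress-suc t t<M ⟩
      progress t + (+ 1 + moverDelta t)
        ≤⟨ ℤ.+-mono-≤ bound (1+m-n≤2 (dist-adjacent T isDistance (v t (r t)) (e , traversed))) ⟩
      + 2 * + length es + + 2          ≡⟨ twice-suc (+ length es) ⟩
      + 2 * + length (e ∷ es)          ∎)
    where
    open ℤ.≤-Reasoning
    twice-suc : ∀ i → + 2 * i + + 2 ≡ + 2 * (+ 1 + i)
    twice-suc = solve-∀

  invariant-approach : ∀ t → t ℕ.< M → ¬ NearUnexplored t (p t (r t)) → Invariant t → Invariant (ℕ.suc t)
  invariant-approach t t<M far (es , unique , explored , bound) =
    es , unique , All.map (explored-suc T p r v) explored ,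
    (begin
      progress (ℕ.suc t)                 ≡⟨ progress-suc t t<M ⟩
      progress t + (+ 1 + moverDelta t)  ≡⟨ cong (λ g → progress t + g) (1+m-n≡0 closer) ⟩
      progress t + + 0                   ≡⟨ ℤ.+-identityʳ _ ⟩
      progress t                         ≤⟨ bound ⟩
      + 2 * + length es                  ∎)
    where
    open ℤ.≤-Reasoning
    closer : ℕ.suc (d (p (ℕ.suc t) (r t)) (v t (r t))) ≡ d (p t (r t)) (v t (r t))
    closer = proj₂ (rule2 t t<M far)

  invariant : ∀ t → t ℕ.≤ M → Invariant t
  invariant ℕ.zero    _   = [] , [] , All.[] , ℤ.≤-reflexive (trans (ℤ.+-identityˡ _) balance-zero)
  invariant (ℕ.suc t) t<M with nearUnexplored? T p r v t (p t (r t))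
  ... | yes near = invariant-explore t t<M near (invariant t (ℕ.<⇒≤ t<M))
  ... | no far   = invariant-approach t t<M far (invariant t (ℕ.<⇒≤ t<M))

  drift-bound : + M - targetDrift d p v M ≤ progress M
  drift-bound = begin
    + M - targetDrift d p v M                   ≡⟨ ℤ.+-identityʳ _ ⟨
    + M - targetDrift d p v M + + 0             ≤⟨ ℤ.+-monoʳ-≤ (+ M - targetDrift d p v M) potential-nonneg ⟩
    + M - targetDrift d p v M + potential M     ≡⟨ regroup (+ M) (potential M) (targetDrift d p v M) ⟩
    progress M                                  ∎
    where
    open ℤ.≤-Reasoning
    potential-nonneg : + 0 ≤ potential M
    potential-nonneg = sumℤ-map-nonneg (λ ρ → d (p M ρ) (v M ρ)) (allFin k)
    regroup : ∀ i P D → i - D + P ≡ i + (P - D)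
    regroup = solve-∀

proposition3p10 : ∀ {n k : ℕ} (T : Tree n) (d : Node T → Node T → ℕ) →
    IsDistance T d →
    (p : ℕ → Fin k → Node T) (r : ℕ → Fin k) (v : ℕ → Fin k → Node T)
    (M : ℕ) → Run.LocallyGreedy T p r v d M →
    ∃[ es ] (Unique es × All (Run.ExploredEdge T p r v M) es ×
             (+ M) - targetDrift d p v M ≤ (+ 2) * (+ length es))
proposition3p10 T d isDistance p r v M greedy =
  let open Exploration T isDistance p r v greedy
      (es , unique , explored , bound) = invariant M ℕ.≤-refl
  in es , unique , explored , ℤ.≤-trans drift-bound bound
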